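{- Let $p:\mathbb E\to\mathbb B$ be a posetal fibration with fibred small limits, $\mathcal T$ a monad on $\mathbb B$, and $X\in\mathbb E$. An object $S\in\mathbb E_{T(pX)}$ is closed with respect to $X$ if and only if $S=[S]^{pX}X$.
   Context: $p$ posetal means each fibre is a poset; $p$ is then faithful and each homset $\mathbb E(X,Y)$ is regarded as a subset of $\mathbb B(pX,pY)$. Fibres admit arbitrary (large) meets $\bigwedge$. $\mathcal T=(T,\eta,\mu)$, Kleisli extension $f^\#=\mu\circ Tf$; $(-)^{ -1}$ denotes inverse image (reindexing). For $R\in\mathbb B$ and $S\in\mathbb E_{TR}$, $[S]^R$ denotes the (pointwise) codensity lifting of $\mathcal T$ with single lifting parameter $(R,S)$; it is a lifting of $\mathcal T$ whose object part is $[S]^RX=\bigwedge_{f\in\mathbb E(X,S)}(f^\#)^{ -1}(S)\in\mathbb E_{T(pX)}$. An object $S\in\mathbb E_{T(pX)}$ is closed with respect to $X$ if (1) $\eta_{pX}\in\mathbb E(X,S)$ and (2) for every $f\in\mathbb E(X,S)$, $f^\#\in\mathbb E(S,S)$. -}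

module Defs where

open import Level using (Level; _⊔_; suc)
open import Data.Product using (Σ; _,_; proj₁; proj₂; _×_)
open import Relation.Binary.Bundles using (Poset)
open import Relation.Binary.Structures using (IsEquivalence)

record Category (o ℓ e : Level) : Set (suc (o ⊔ ℓ ⊔ e)) where
  infixr 9 _∘_
  infix  4 _≈_
  field
    Obj   : Set o
    Hom   : Obj → Obj → Set ℓ
    _≈_   : ∀ {A B} → Hom A B → Hom A B → Set e
    ≈-equiv : ∀ {A B} → IsEquivalence (_≈_ {A} {B})
    id    : ∀ {A} → Hom A A
    _∘_   : ∀ {A B C} → Hom B C → Hom A B → Hom A C
    ∘-resp-≈ : ∀ {A B C} {f f' : Hom B C} {g g' : Hom A B} →
               f ≈ f' → g ≈ g' → f ∘ g ≈ f' ∘ g'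
    identityˡ : ∀ {A B} {f : Hom A B} → id ∘ f ≈ f
    identityʳ : ∀ {A B} {f : Hom A B} → f ∘ id ≈ f
    assoc : ∀ {A B C D} {f : Hom A B} {g : Hom B C} {h : Hom C D} →
            (h ∘ g) ∘ f ≈ h ∘ (g ∘ f)

record Monad {o ℓ e : Level} (B : Category o ℓ e) : Set (o ⊔ ℓ ⊔ e) where
  open Category B
  field
    T₀ : Obj → Obj
    T₁ : ∀ {A C} → Hom A C → Hom (T₀ A) (T₀ C)
    T-resp-≈ : ∀ {A C} {f g : Hom A C} → f ≈ g → T₁ f ≈ T₁ g
    T-identity : ∀ {A} → T₁ (id {A}) ≈ id
    T-homomorphism : ∀ {A C D} {f : Hom A C} {g : Hom C D} →
                     T₁ (g ∘ f) ≈ T₁ g ∘ T₁ f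
    η : ∀ A → Hom A (T₀ A)
    μ : ∀ A → Hom (T₀ (T₀ A)) (T₀ A)
    η-natural : ∀ {A C} {f : Hom A C} → η C ∘ f ≈ T₁ f ∘ η A
    μ-natural : ∀ {A C} {f : Hom A C} → μ C ∘ T₁ (T₁ f) ≈ T₁ f ∘ μ A
    μ-assoc : ∀ {A} → μ A ∘ T₁ (μ A) ≈ μ A ∘ μ (T₀ A)
    μ-identityˡ : ∀ {A} → μ A ∘ T₁ (η A) ≈ id
    μ-identityʳ : ∀ {A} → μ A ∘ η (T₀ A) ≈ id

  ext : ∀ {A C} → Hom A (T₀ C) → Hom (T₀ A) (T₀ C)
  ext {C = C} f = μ C ∘ T₁ f

-- A posetal fibration p : E → B with fibred small limits, presented by its
-- fibres E_I (posets), its reindexing (inverse image) maps f⁻¹ : E_J → E_I,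
-- and fibrewise meets (indexed by types of the size of B's homsets and the
-- fibre order) that are preserved by reindexing.
record PosetalFibration {o ℓ e : Level} (B : Category o ℓ e) (a q r : Level)
       : Set (suc (o ⊔ ℓ ⊔ e ⊔ a ⊔ q ⊔ r)) where
  open Category B using (Obj; Hom; id; _∘_) renaming (_≈_ to _≈B_)
  field
    fibre : Obj → Poset a q r
  module Fib (I : Obj) = Poset (fibre I)
  open Fib using () renaming (Carrier to E_; _≈_ to ≈-at; _≤_ to ≤-at) public
  field
    reindex : ∀ {I J} → Hom I J → E_ J → E_ I
    reindex-mono : ∀ {I J} (f : Hom I J) {X Y : E_ J} →
                   ≤-at J X Y → ≤-at I (reindex f X) (reindex f Y)
    reindex-resp : ∀ {I J} {f g : Hom I J} → f ≈B g → (X : E_ J) →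
                   ≈-at I (reindex f X) (reindex g X)
    reindex-id : ∀ {I} (X : E_ I) → ≈-at I (reindex id X) X
    reindex-∘ : ∀ {I J K} (f : Hom I J) (g : Hom J K) (X : E_ K) →
                ≈-at I (reindex (g ∘ f) X) (reindex f (reindex g X))
    ⋀ : ∀ {I} {K : Set (ℓ ⊔ r)} → (K → E_ I) → E_ I
    ⋀-lower : ∀ {I} {K : Set (ℓ ⊔ r)} (F : K → E_ I) (k : K) → ≤-at I (⋀ F) (F k)
    ⋀-greatest : ∀ {I} {K : Set (ℓ ⊔ r)} (F : K → E_ I) (Y : E_ I) →
                 (∀ k → ≤-at I Y (F k)) → ≤-at I Y (⋀ F)
    reindex-⋀ : ∀ {I J} (f : Hom I J) {K : Set (ℓ ⊔ r)} (F : K → E_ J) →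
                ≈-at I (reindex f (⋀ F)) (⋀ (λ k → reindex f (F k)))

  -- Objects of the total category E, and the functor p.
  Ob : Set (o ⊔ a)
  Ob = Σ Obj E_

  p : Ob → Obj
  p = proj₁

  -- E(X,Y) as a subset of B(pX,pY): f ∈ E(X,Y) iff X ≤ f⁻¹ Y in the fibre.
  _∈E[_,_] : ∀ {I J} → Hom I J → E_ I → E_ J → Set r
  _∈E[_,_] {I} f X Y = ≤-at I X (reindex f Y)

module _ {o ℓ e a q r : Level} {B : Category o ℓ e}
         (P : PosetalFibration B a q r) (M : Monad B) where
  open Category B
  open PosetalFibration P
  open Monad M

  -- Object part of the codensity lifting [S]^R with parameter (R,S), at X:
  -- [S]^R X = ⋀_{f ∈ E(X,S)} (f^#)⁻¹ S  ∈ E_{T(pX)}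
  codensity : (R : Obj) → E_ (T₀ R) → (X : Ob) → E_ (T₀ (p X))
  codensity R S (I , X) =
    ⋀ {K = Σ (Hom I (T₀ R)) (λ f → f ∈E[ X , S ])} (λ k → reindex (ext (proj₁ k)) S)

  Closed : (X : Ob) → E_ (T₀ (p X)) → Set (ℓ ⊔ r)
  Closed (I , X) S =
    (η I ∈E[ X , S ]) × (∀ (f : Hom I (T₀ I)) → f ∈E[ X , S ] → ext f ∈E[ S , S ])

module Submission where

open import Defs
open import Level using (Level; _⊔_)
open import Function.Bundles using (_⇔_; mk⇔)
open import Data.Product using (_,_)
open import Relation.Binary.Structures using (IsEquivalence)
open import Relation.Binary.Bundles using (Setoid)
import Relation.Binary.Reasoning.Setoid as SetoidReasoning

-- Write [S] for [S]^{pX} X = ⋀_{f ∈ E(X,S)} (f^#)⁻¹ S.  Condition (2) of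
-- closedness says exactly that S lies below every term of this meet, so
-- S ≤ [S]; and since η^# = id, the term at f = η is S itself, so (1) gives
-- [S] ≤ S.  Conversely, for any parameter η ∈ E(X,[S]) because f^# ∘ η = f,
-- and f^# ∈ E([S],S) for f ∈ E(X,S); when S = [S] these are (1) and (2).

module _ {o ℓ e : Level} {B : Category o ℓ e} (M : Monad B) where
  open Category B
  open Monad M

  ext-∘-η : ∀ {I C} (f : Hom I (T₀ C)) → ext f ∘ η I ≈ f
  ext-∘-η {I} {C} f = begin
    (μ C ∘ T₁ f) ∘ η I   ≈⟨ assoc ⟩
    μ C ∘ (T₁ f ∘ η I)   ≈⟨ ∘-resp-≈ ≈B.refl (≈B.sym η-natural) ⟩
    μ C ∘ (η (T₀ C) ∘ f) ≈⟨ ≈B.sym assoc ⟩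
    (μ C ∘ η (T₀ C)) ∘ f ≈⟨ ∘-resp-≈ μ-identityʳ ≈B.refl ⟩
    id ∘ f               ≈⟨ identityˡ ⟩
    f                    ∎
    where
    module ≈B {A D} = IsEquivalence (≈-equiv {A} {D})
    homSetoid : Setoid ℓ e
    homSetoid = record { isEquivalence = ≈-equiv {I} {T₀ C} }
    open SetoidReasoning homSetoid

module _ {o ℓ e a q r : Level} {B : Category o ℓ e} (P : PosetalFibration B a q r) where
  open Category B
  open PosetalFibration P
  private module ≈B {A C} = IsEquivalence (≈-equiv {A} {C})

  ∈E-resp-≈ : ∀ {I J} {f g : Hom I J} {X : E_ I} {Y : E_ J} →
              f ≈ g → f ∈E[ X , Y ] → g ∈E[ X , Y ]
  ∈E-resp-≈ {I} f≈g f∈ = Fib.trans I f∈ (Fib.reflexive I (reindex-resp f≈g _))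

  ∈E-monoʳ : ∀ {I J} {f : Hom I J} {X : E_ I} {Y Y' : E_ J} →
             ≤-at J Y Y' → f ∈E[ X , Y ] → f ∈E[ X , Y' ]
  ∈E-monoʳ {I} {f = f} Y≤Y' f∈ = Fib.trans I f∈ (reindex-mono f Y≤Y')

  ∈E-antiˡ : ∀ {I J} {f : Hom I J} {X X' : E_ I} {Y : E_ J} →
             ≤-at I X' X → f ∈E[ X , Y ] → f ∈E[ X' , Y ]
  ∈E-antiˡ {I} X'≤X f∈ = Fib.trans I X'≤X f∈

  ∘-∈E⇒∈E-reindex : ∀ {I J K} {f : Hom I J} {g : Hom J K} {X : E_ I} {Z : E_ K} →
                    (g ∘ f) ∈E[ X , Z ] → f ∈E[ X , reindex g Z ]
  ∘-∈E⇒∈E-reindex {I} {f = f} {g} g∘f∈ =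
    Fib.trans I g∘f∈ (Fib.reflexive I (reindex-∘ f g _))

  ∈E-⋀ : ∀ {I J} {f : Hom I J} {X : E_ I} {K : Set (ℓ ⊔ r)} {F : K → E_ J} →
         (∀ k → f ∈E[ X , F k ]) → f ∈E[ X , ⋀ F ]
  ∈E-⋀ {I} {f = f} {X} {F = F} f∈ =
    Fib.trans I (⋀-greatest _ X f∈) (Fib.reflexive I (Fib.Eq.sym I (reindex-⋀ f F)))

  id-∈E⇒≤ : ∀ {I} {X Y : E_ I} → id ∈E[ X , Y ] → ≤-at I X Y
  id-∈E⇒≤ {I} id∈ = Fib.trans I id∈ (Fib.reflexive I (reindex-id _))

  module _ (M : Monad B) where
    open Monad M

    ext-∈E-codensity : ∀ {R} {S : E_ (T₀ R)} {I} {X : E_ I} {f : Hom I (T₀ R)} →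
                       f ∈E[ X , S ] → ext f ∈E[ codensity P M R S (I , X) , S ]
    ext-∈E-codensity {f = f} f∈ = ⋀-lower _ (f , f∈)

    ≤-codensity : ∀ {R} {S : E_ (T₀ R)} {I} {X : E_ I} (Y : E_ (T₀ I)) →
                  (∀ (f : Hom I (T₀ R)) → f ∈E[ X , S ] → ext f ∈E[ Y , S ]) →
                  ≤-at (T₀ I) Y (codensity P M R S (I , X))
    ≤-codensity Y ext∈ = ⋀-greatest _ Y (λ (f , f∈) → ext∈ f f∈)

    η-∈E-codensity : ∀ {R} {S : E_ (T₀ R)} {I} {X : E_ I} →
                     η I ∈E[ X , codensity P M R S (I , X) ]
    η-∈E-codensity = ∈E-⋀ (λ (f , f∈) →
      ∘-∈E⇒∈E-reindex (∈E-resp-≈ (≈B.sym (ext-∘-η M f)) f∈))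

    codensity-≤ : ∀ {I} {X : E_ I} {S : E_ (T₀ I)} →
                  η I ∈E[ X , S ] → ≤-at (T₀ I) (codensity P M I S (I , X)) S
    codensity-≤ η∈ = id-∈E⇒≤ (∈E-resp-≈ μ-identityˡ (ext-∈E-codensity η∈))

proposition8p3 : ∀ {o ℓ e a q r : Level} {B : Category o ℓ e}
    (P : PosetalFibration B a q r) (M : Monad B)
    (X : PosetalFibration.Ob P)
    (S : PosetalFibration.E_ P (Monad.T₀ M (PosetalFibration.p P X))) →
    Closed P M X S ⇔ PosetalFibration.≈-at P (Monad.T₀ M (PosetalFibration.p P X))
    S (codensity P M (PosetalFibration.p P X) S X)
proposition8p3 P M (I , X) S = mk⇔ closed⇒fixed fixed⇒closed
  where
  open PosetalFibration P
  open Monad M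
  C = codensity P M I S (I , X)

  closed⇒fixed : Closed P M (I , X) S → ≈-at (T₀ I) S C
  closed⇒fixed (η∈ , ext∈) =
    Fib.antisym (T₀ I) (≤-codensity P M S ext∈) (codensity-≤ P M η∈)

  fixed⇒closed : ≈-at (T₀ I) S C → Closed P M (I , X) S
  fixed⇒closed S≈C =
      ∈E-monoʳ P (Fib.reflexive (T₀ I) (Fib.Eq.sym (T₀ I) S≈C)) (η-∈E-codensity P M)
    , λ f f∈ → ∈E-antiˡ P (Fib.reflexive (T₀ I) S≈C) (ext-∈E-codensity P M f∈)
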